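{- (Provable in $\mathsf{PRS}\omega\mathsf{U}(\mathsf{enu})$.) For every ordinal $\alpha$, the map $\iota$ restricted to $\dot V_\alpha(Q)$ maps into the indecomposable sequences of length $<\omega^{1+\alpha}$ and is order-preserving and order-reflecting from $(\dot V_\alpha(Q),\lesssim_Q)$ to (transfinite sequences, $\preceq$), i.e. $x\lesssim_Q y\iff\iota(x)\preceq\iota(y)$ for $x,y\in\dot V_\alpha(Q)$. Likewise, $\iota$ restricted to $\dot V_\alpha(Q)$ maps into the weakly indecomposable sequences of length $<\omega^{1+\alpha}$ and satisfies $x\lesssim^*_Q y\iff\iota(x)\preceq^*\iota(y)$ for $x,y\in\dot V_\alpha(Q)$.
   Context: Base theory: primitive recursive set theory with infinity and urelements, extended by a function $\mathsf{enu}$ such that for every non-empty set $x$, $n\mapsto\mathsf{enu}(x,n)$ ($n\in\omega$) maps $\omega$ onto $x$. $Q$ is a class of urelements with quasi-order $\le_Q$. Hierarchy: rank of sets ignores urelements ($\mathrm{rk}(x)\le\alpha$ iff $\mathrm{rk}(y)<\alpha$ for all $y\in x$ with $y\notin Q$). $\dot V(Q)$: urelements in $Q$ and non-empty sets over $Q$ whose transitive closure does not contain $\emptyset$; $\dot V_\alpha(Q)$: urelements and sets of rank $<\alpha$ in $\dot V(Q)$. By $\in$-recursion: for $x,y\in Q$, $x\lesssim_Q y$ and $x\lesssim^*_Q y$ iff $x\le_Q y$; for sets $x,y$, $x\lesssim_Q y$ iff $\forall x'\in x\,\exists y'\in y\,x'\lesssim_Q y'$ (same for $*$); for $x\in Q$,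 $y$ a set, $x\lesssim_Q y$ iff $\{x\}\lesssim_Q y$ (same for $*$); for $x$ a set, $y\in Q$, $x\lesssim_Q y$ is false and $x\lesssim^*_Q y$ iff $x\lesssim^*_Q\{y\}$. Sequences: a transfinite sequence is a function $u$ from a non-zero ordinal $|u|$ to $Q$; an element $q\in Q$ is identified with the length-1 sequence $q$; $\sum_{i<\omega}u_i$ is concatenation. An embedding (weak embedding) of $u$ into $v$ is a strictly (non-strictly) increasing $f:|u|\to|v|$ with $u(\beta)\le_Q v(f(\beta))$, written $u\preceq v$ ($u\preceq^*v$). Tails: $u{\restriction}_{[\alpha,|u|)}:\gamma\mapsto u(\alpha+\gamma)$, $\alpha<|u|$. $u$ is (weakly) indecomposable if it (weakly) embeds into each tail. The map $\iota$: $\iota(q)=q$ for $q\in Q$, and $\iota(x)=\sum_{i<\omega}\iota(\mathsf{enu}(x,h(i)))$ for sets $x$, where $h:\omega\to\omega$ is the fixed function $h(n)=$ remainder of $n$ upon division by $\lfloor\sqrt{n+1}\rfloor$ (so every natural number has infinitely many $h$-preimages). -}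

module Defs where

open import Level using (0ℓ)
open import Data.Nat using (ℕ; zero; suc; _+_; _*_; _∸_; _≤ᵇ_) renaming (_<_ to _<ℕ_)
open import Data.Nat.DivMod using (_%_)
open import Data.Bool using (if_then_else_)
open import Data.Unit using (⊤; tt)
open import Data.Empty using (⊥)
open import Data.Maybe using (Maybe; nothing; just)
open import Data.List using (List; []; _∷_)
open import Data.Product using (Σ; ∃; _×_; _,_; proj₁)
open import Data.Sum using (_⊎_)
open import Relation.Binary.PropositionalEquality using (_≡_)

isqrt : ℕ → ℕ
isqrt zero = zero
isqrt (suc n) with isqrt n
... | r = if (suc r * suc r) ≤ᵇ suc n then suc r else r

-- ⌊√(n+1)⌋ ≥ 1, so ⌊√(n+1)⌋ = suc (⌊√(n+1)⌋ ∸ 1); written this way so that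
-- the divisor is syntactically non-zero.
h : ℕ → ℕ
h n = n % suc (isqrt (suc n) ∸ 1)

-- Hereditarily non-empty sets over urelements Q, each set given together
-- with its enumeration n ↦ enu(x,n).  `st f` is the set {f n | n ∈ ω}
-- with enu(st f, n) = f n.  These are exactly the objects of V̇(Q):
-- urelements, or non-empty (countable) sets whose transitive closure
-- does not contain ∅.

data V (Q : Set) : Set where
  ur : Q → V Q
  st : (ℕ → V Q) → V Q

module Embeddability {Q : Set} (_≤Q_ : Q → Q → Set) where

  _≲_ : V Q → V Q → Set
  ur x ≲ ur y = x ≤Q y
  st f ≲ st g = ∀ n → ∃ λ m → f n ≲ g m
  ur x ≲ st g = ∃ λ m → ur x ≲ g m          -- {x} ≲ y
  st f ≲ ur y = ⊥

  _≲*_ : V Q → V Q → Set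
  ur x ≲* ur y = x ≤Q y
  st f ≲* st g = ∀ n → ∃ λ m → f n ≲* g m
  ur x ≲* st g = ∃ λ m → ur x ≲* g m        -- {x} ≲* y
  st f ≲* ur y = ∀ n → f n ≲* ur y          -- x ≲* {y}

module Rank {Q : Set} {A : Set} (_<_ : A → A → Set) where

  mutual
    RkLe : V Q → A → Set
    RkLe (ur q) β = ⊤
    RkLe (st f) β = ∀ n → ChildOK (f n) β

    ChildOK : V Q → A → Set
    ChildOK (ur q) β = ⊤
    ChildOK (st g) β = ∃ λ γ → γ < β × RkLe (st g) γ

  -- x ∈ V̇_α(Q), where α is the order type of (A , _<_)
  InV : V Q → Set
  InV (ur q) = ⊤
  InV (st f) = ∃ λ β → RkLe (st f) β

record Seq (Q : Set) : Set₁ where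
  field
    Carrier : Set
    _<_     : Carrier → Carrier → Set
    lab     : Carrier → Q

module Sequences {Q : Set} (_≤Q_ : Q → Q → Set) where

  open Seq

  _⪯_ : Seq Q → Seq Q → Set
  u ⪯ v = Σ (Carrier u → Carrier v) λ f →
            (∀ a b → _<_ u a b → _<_ v (f a) (f b))
          × (∀ a → lab u a ≤Q lab v (f a))

  _⪯*_ : Seq Q → Seq Q → Set
  u ⪯* v = Σ (Carrier u → Carrier v) λ f →
             (∀ a b → _<_ u a b → (f a ≡ f b ⊎ _<_ v (f a) (f b)))
           × (∀ a → lab u a ≤Q lab v (f a))

  Tail : (u : Seq Q) → Carrier u → Seq Q
  Tail u a = record
    { Carrier = Σ (Carrier u) (λ b → a ≡ b ⊎ _<_ u a b)
    ; _<_     = λ b c → _<_ u (proj₁ b) (proj₁ c)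
    ; lab     = λ b → lab u (proj₁ b) }

  Indecomposable : Seq Q → Set
  Indecomposable u = ∀ a → u ⪯ Tail u a

  WeaklyIndecomposable : Seq Q → Set
  WeaklyIndecomposable u = ∀ a → u ⪯* Tail u a

  single : Q → Seq Q
  single q = record { Carrier = ⊤ ; _<_ = λ _ _ → ⊥ ; lab = λ _ → q }

  data ConcLt (us : ℕ → Seq Q) : Σ ℕ (λ i → Carrier (us i))
                               → Σ ℕ (λ i → Carrier (us i)) → Set where
    lt-out : ∀ {i j a b} → i <ℕ j → ConcLt us (i , a) (j , b)
    lt-in  : ∀ {i a b} → _<_ (us i) a b → ConcLt us (i , a) (i , b)

  conc : (ℕ → Seq Q) → Seq Q
  conc us = record
    { Carrier = Σ ℕ (λ i → Carrier (us i))
    ; _<_     = ConcLt us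
    ; lab     = λ p → lab (us (proj₁ p)) (proj₂' p) }
    where
      proj₂' : (p : Σ ℕ (λ i → Carrier (us i))) → Carrier (us (proj₁ p))
      proj₂' (_ , a) = a

  ι : V Q → Seq Q
  ι (ur q) = single q
  ι (st f) = conc (λ i → ι (f (h i)))

-- The ordinal ω^(1+α) in Cantor normal form, for α = (A , _<_).

module OmegaPower {A : Set} (_<_ : A → A → Set) where

  -- the ordinal 1+α : a new least element `nothing` below α
  data _<₁_ : Maybe A → Maybe A → Set where
    bot< : ∀ {a} → nothing <₁ just a
    jst< : ∀ {a b} → a < b → just a <₁ just b

  -- a term (e , k) stands for ω^e · (k+1)
  CNF : Set
  CNF = List (Maybe A × ℕ)

  data Decreasing : CNF → Set where
    dec-[] : Decreasing []
    dec-1  : ∀ {t} → Decreasing (t ∷ [])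
    dec-∷  : ∀ {e k e' k' l} → e' <₁ e → Decreasing ((e' , k') ∷ l)
           → Decreasing ((e , k) ∷ (e' , k') ∷ l)

  data _<ω_ : CNF → CNF → Set where
    []<  : ∀ {t l} → [] <ω (t ∷ l)
    exp< : ∀ {e e' k k' l l'} → e' <₁ e → ((e' , k') ∷ l') <ω ((e , k) ∷ l)
    coe< : ∀ {e k k' l l'} → k' <ℕ k → ((e , k') ∷ l') <ω ((e , k) ∷ l)
    tl<  : ∀ {e k l l'} → l' <ω l → ((e , k) ∷ l') <ω ((e , k) ∷ l)

  -- |u| < ω^(1+α): u is order-isomorphic to a proper initial segment
  -- {e ∈ ω^(1+α) | e < e0} of ω^(1+α).
  LengthBelow : {Q : Set} → Seq Q → Set
  LengthBelow u =
    ∃ λ e0 → Decreasing e0 × (Σ (Seq.Carrier u → CNF) λ f →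
        (∀ a → Decreasing (f a) × f a <ω e0)
      × (∀ a b → Seq._<_ u a b → f a <ω f b)
      × (∀ a b → f a <ω f b → Seq._<_ u a b)
      × (∀ a b → f a ≡ f b → a ≡ b)
      × (∀ e → Decreasing e → e <ω e0 → ∃ λ a → f a ≡ e))

-- ι x concatenates ω blocks, the images of the elements of x, each element recurring in
-- infinitely many blocks because every n has infinitely many h-preimages.  Recurrence makes
-- ι x indecomposable and lets blockwise embeddings be spread along a strictly increasing
-- choice of blocks, which gives x ≲ y ⇒ ι x ⪯ ι y.  Conversely, an embedding of ι x into ι y
-- maps a block of ι x below the image of the next block, so (classically) its block index is
-- eventually constant along that block; by indecomposability the whole block embeds into the
-- corresponding tail, hence into a single block of ι y, and induction on x concludes.  The
-- weak variant is identical.  Finally ι x has order type ω^(1+rk x), since ω^(e 0) + ω^(e 1)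
-- + ⋯ = ω^E whenever all e i < E and every d < E is below infinitely many e i.

{-# OPTIONS --safe #-}
module Submission where

open import Defs
open import Level using (0ℓ)
open import Function using (_∘_; id)
open import Data.Nat using (ℕ; zero; suc; _+_; _*_; _∸_; _%_; _≤ᵇ_; z≤n; s≤s)
import Data.Nat.Properties as ℕ
open import Data.Nat.DivMod using ([m+kn]%n≡m%n; m<n⇒m%n≡m)
open import Data.Bool using (true; false; T)
open import Data.Unit using (⊤; tt)
open import Data.Empty using (⊥-elim)
open import Data.Maybe using (Maybe; nothing; just)
open import Data.List using ([]; _∷_)
open import Data.Product using (Σ; ∃; ∃₂; _×_; _,_; proj₁; proj₂)
open import Data.Sum as Sum using (_⊎_; inj₁; inj₂)
open import Relation.Nullary using (¬_; yes; no)
open import Relation.Binary.PropositionalEquality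
open import Relation.Binary.Definitions
  using (Reflexive; Transitive; Trans; Trichotomous; Tri; tri<; tri≈; tri>)
open import Relation.Binary.Structures using (IsStrictTotalOrder)
open import Induction.WellFounded using (WellFounded; Acc; acc)
open import Axiom.ExcludedMiddle using (ExcludedMiddle)

module StrictOrderFacts {X : Set} {_<_ : X → X → Set}
                        (<-irrefl : ∀ {x} → ¬ x < x) (<-trans : Transitive _<_) where

  open import Relation.Binary.Construct.StrictToNonStrict _≡_ _<_ as NonStrict public
    using (_≤_)

  <-asym : ∀ {x y} → x < y → ¬ y < x
  <-asym x<y y<x = <-irrefl (<-trans x<y y<x)

  tri-< : ∀ {x y} → x < y → Tri (x < y) (x ≡ y) (y < x)
  tri-< x<y = tri< x<y (λ { refl → <-irrefl x<y }) (<-asym x<y)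

  tri-> : ∀ {x y} → y < x → Tri (x < y) (x ≡ y) (y < x)
  tri-> y<x = tri> (<-asym y<x) (λ { refl → <-irrefl y<x }) y<x

  tri-≈ : ∀ {x} → Tri (x < x) (x ≡ x) (x < x)
  tri-≈ = tri≈ <-irrefl refl <-irrefl

  ≤-trans : Transitive _≤_
  ≤-trans = NonStrict.trans isEquivalence (resp₂ _<_) <-trans

  <-≤-trans : Trans _<_ _≤_ _<_
  <-≤-trans = NonStrict.<-≤-trans <-trans (proj₁ (resp₂ _<_))

  ≤-<-trans : Trans _≤_ _<_ _<_
  ≤-<-trans = NonStrict.≤-<-trans sym <-trans (proj₂ (resp₂ _<_))

  module _ (compare : Trichotomous _≡_ _<_) where

    ≮⇒≥ : ∀ {x y} → ¬ x < y → y ≤ x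
    ≮⇒≥ {x} {y} x≮y with compare x y
    ... | tri< x<y _ _ = ⊥-elim (x≮y x<y)
    ... | tri≈ _ x≡y _ = inj₂ (sym x≡y)
    ... | tri> _ _ y<x = inj₁ y<x

    ≰⇒> : ∀ {x y} → ¬ x ≤ y → y < x
    ≰⇒> {x} {y} x≰y with compare x y
    ... | tri< x<y _ _ = ⊥-elim (x≰y (inj₁ x<y))
    ... | tri≈ _ x≡y _ = ⊥-elim (x≰y (inj₂ x≡y))
    ... | tri> _ _ y<x = y<x

open import Data.Nat using (_≤_; _<_)

open Seq using (Carrier; lab)

infix 4 _∶_≺_
_∶_≺_ : {Q : Set} (u : Seq Q) → Carrier u → Carrier u → Set
u ∶ a ≺ b = Seq._<_ u a b

IsFloorSqrt : ℕ → ℕ → Set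
IsFloorSqrt n s = s * s ≤ n × n < suc s * suc s

isqrt-isFloorSqrt : ∀ n → IsFloorSqrt n (isqrt n)
isqrt-isFloorSqrt zero = z≤n , s≤s z≤n
isqrt-isFloorSqrt (suc n) with isqrt n | isqrt-isFloorSqrt n
... | r | (r²≤n , n<[1+r]²) with suc r * suc r ≤ᵇ suc n in test
... | true  = ℕ.≤ᵇ⇒≤ (suc r * suc r) (suc n) (subst T (sym test) tt)
            , ℕ.≤-trans (s≤s n<[1+r]²) (ℕ.*-mono-< {suc r} {suc (suc r)} ℕ.≤-refl ℕ.≤-refl)
... | false = ℕ.≤-trans r²≤n (ℕ.n≤1+n n) , ℕ.≰⇒> (subst T test ∘ ℕ.≤⇒≤ᵇ)

floorSqrt-unique : ∀ {n s t} → IsFloorSqrt n s → IsFloorSqrt n t → s ≡ t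
floorSqrt-unique {s = s} {t} (s²≤n , n<[1+s]²) (t²≤n , n<[1+t]²) with ℕ.<-cmp s t
... | tri< s<t _ _ =
  ⊥-elim (ℕ.<-irrefl refl (ℕ.<-≤-trans n<[1+s]² (ℕ.≤-trans (ℕ.*-mono-≤ s<t s<t) t²≤n)))
... | tri≈ _ s≡t _ = s≡t
... | tri> _ _ t<s =
  ⊥-elim (ℕ.<-irrefl refl (ℕ.<-≤-trans n<[1+t]² (ℕ.≤-trans (ℕ.*-mono-≤ t<s t<s) s²≤n)))

-- The witness is i = s * s + m with s = 1 + m + N: then ⌊√(i+1)⌋ = s > m, so h i = i % s = m.
h-preimage : ∀ m N → ∃ λ i → N < i × h i ≡ m
h-preimage m N = i , N<i , hi≡m
  where
  s = suc (m + N)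
  i = s * s + m
  m<s : m < s
  m<s = s≤s (ℕ.m≤m+n m N)

  √[1+i]≡s : isqrt (suc i) ≡ s
  √[1+i]≡s = sym (floorSqrt-unique (s²≤1+i , 1+i<[1+s]²) (isqrt-isFloorSqrt (suc i)))
    where
    s²≤1+i : s * s ≤ suc i
    s²≤1+i = ℕ.≤-trans (ℕ.m≤m+n (s * s) m) (ℕ.n≤1+n i)
    1+i<[1+s]² : suc i < suc s * suc s
    1+i<[1+s]² = s≤s (begin
      suc (s * s + m) ≡⟨ sym (ℕ.+-suc (s * s) m) ⟩
      s * s + suc m   ≤⟨ ℕ.+-monoʳ-≤ (s * s) m<s ⟩
      s * s + s       ≤⟨ ℕ.m≤n+m (s * s + s) s ⟩
      s + (s * s + s) ≡⟨ cong (s +_) (trans (ℕ.+-comm (s * s) s) (sym (ℕ.*-suc s s))) ⟩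
      s + s * suc s   ∎)
      where open ℕ.≤-Reasoning

  N<i : N < i
  N<i = ℕ.<-≤-trans (s≤s (ℕ.m≤n+m N m)) (ℕ.≤-trans (ℕ.m≤m*n s s) (ℕ.m≤m+n (s * s) m))

  hi≡m : h i ≡ m
  hi≡m = begin
    i % suc (isqrt (suc i) ∸ 1) ≡⟨ cong (λ r → i % suc (r ∸ 1)) √[1+i]≡s ⟩
    (s * s + m) % s             ≡⟨ cong (_% s) (ℕ.+-comm (s * s) m) ⟩
    (m + s * s) % s             ≡⟨ [m+kn]%n≡m%n m s s ⟩
    m % s                       ≡⟨ m<n⇒m%n≡m m<s ⟩
    m                           ∎
    where open ≡-Reasoning

h-recurring : (P : ℕ → Set) → ∀ {m} → P m → ∀ N → ∃ λ l → N < l × P (h l)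
h-recurring P {m} Pm N with h-preimage m N
... | l , N<l , hl≡m = l , N<l , subst P (sym hl≡m) Pm

module IncreasingChoice {P : ℕ → ℕ → Set} (choose : ∀ k N → ∃ λ l → N < l × P k l) (N : ℕ)
  where

  σ : ℕ → ℕ
  σ zero    = proj₁ (choose zero N)
  σ (suc k) = proj₁ (choose (suc k) (σ k))

  σ-spec : ∀ k → P k (σ k)
  σ-spec zero    = proj₂ (proj₂ (choose zero N))
  σ-spec (suc k) = proj₂ (proj₂ (choose (suc k) (σ k)))

  σ-step : ∀ k → σ k < σ (suc k)
  σ-step k = proj₁ (proj₂ (choose (suc k) (σ k)))

  N<σ : ∀ k → N < σ k
  N<σ zero    = proj₁ (proj₂ (choose zero N))
  N<σ (suc k) = ℕ.<-trans (N<σ k) (σ-step k)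

  σ-strictMono : ∀ {k l} → k < l → σ k < σ l
  σ-strictMono {k} {suc l} (s≤s k≤l) with ℕ.m≤n⇒m<n∨m≡n k≤l
  ... | inj₁ k<l  = ℕ.<-trans (σ-strictMono k<l) (σ-step l)
  ... | inj₂ refl = σ-step l

module CantorNormalForm {A : Set} {_⊏_ : A → A → Set} (⊏-sto : IsStrictTotalOrder _≡_ _⊏_) where

  open OmegaPower _⊏_
  open IsStrictTotalOrder ⊏-sto using () renaming (irrefl to ⊏-irrefl; trans to ⊏-trans)

  <₁-irrefl : ∀ {e} → ¬ e <₁ e
  <₁-irrefl (jst< p) = ⊏-irrefl refl p

  <₁-trans : Transitive _<₁_
  <₁-trans bot<     (jst< _) = bot<
  <₁-trans (jst< p) (jst< q) = jst< (⊏-trans p q)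

  module O₁ = StrictOrderFacts {_<_ = _<₁_} <₁-irrefl <₁-trans
  open O₁ public using () renaming (_≤_ to _≤₁_)

  <₁-cmp : Trichotomous _≡_ _<₁_
  <₁-cmp nothing  nothing  = O₁.tri-≈
  <₁-cmp nothing  (just _) = O₁.tri-< bot<
  <₁-cmp (just _) nothing  = O₁.tri-> bot<
  <₁-cmp (just a) (just b) with IsStrictTotalOrder.compare ⊏-sto a b
  ... | tri< a⊏b _ _ = O₁.tri-< (jst< a⊏b)
  ... | tri≈ _ refl _ = O₁.tri-≈
  ... | tri> _ _ b⊏a = O₁.tri-> (jst< b⊏a)

  nothing≤₁ : ∀ e → nothing ≤₁ e
  nothing≤₁ nothing  = inj₂ refl
  nothing≤₁ (just _) = inj₁ bot<

  <ω-irrefl : ∀ {α} → ¬ α <ω α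
  <ω-irrefl (exp< p) = <₁-irrefl p
  <ω-irrefl (coe< p) = ℕ.<-irrefl refl p
  <ω-irrefl (tl< p)  = <ω-irrefl p

  <ω-trans : Transitive _<ω_
  <ω-trans []<      (exp< _) = []<
  <ω-trans []<      (coe< _) = []<
  <ω-trans []<      (tl< _)  = []<
  <ω-trans (exp< p) (exp< q) = exp< (<₁-trans p q)
  <ω-trans (exp< p) (coe< _) = exp< p
  <ω-trans (exp< p) (tl< _)  = exp< p
  <ω-trans (coe< _) (exp< q) = exp< q
  <ω-trans (coe< p) (coe< q) = coe< (ℕ.<-trans p q)
  <ω-trans (coe< p) (tl< _)  = coe< p
  <ω-trans (tl< _)  (exp< q) = exp< q
  <ω-trans (tl< _)  (coe< q) = coe< q
  <ω-trans (tl< p)  (tl< q)  = tl< (<ω-trans p q)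

  module Oω = StrictOrderFacts {_<_ = _<ω_} <ω-irrefl <ω-trans
  open Oω public using () renaming (_≤_ to _≤ω_)

  <ω-cmp : Trichotomous _≡_ _<ω_
  <ω-cmp []      []      = Oω.tri-≈
  <ω-cmp []      (_ ∷ _) = Oω.tri-< []<
  <ω-cmp (_ ∷ _) []      = Oω.tri-> []<
  <ω-cmp ((e , k) ∷ α) ((e′ , k′) ∷ α′) with <₁-cmp e e′
  ... | tri< p _ _ = Oω.tri-< (exp< p)
  ... | tri> _ _ p = Oω.tri-> (exp< p)
  ... | tri≈ _ refl _ with ℕ.<-cmp k k′
  ...   | tri< p _ _ = Oω.tri-< (coe< p)
  ...   | tri> _ _ p = Oω.tri-> (coe< p)
  ...   | tri≈ _ refl _ with <ω-cmp α α′
  ...     | tri< p _ _ = Oω.tri-< (tl< p)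
  ...     | tri> _ _ p = Oω.tri-> (tl< p)
  ...     | tri≈ _ refl _ = Oω.tri-≈

  head-≤₁ : ∀ {d j β d′ j′ β′} → ((d , j) ∷ β) ≤ω ((d′ , j′) ∷ β′) → d ≤₁ d′
  head-≤₁ (inj₁ (exp< p)) = inj₁ p
  head-≤₁ (inj₁ (coe< _)) = inj₂ refl
  head-≤₁ (inj₁ (tl< _))  = inj₂ refl
  head-≤₁ (inj₂ refl)     = inj₂ refl

  infix 40 ω^_·suc_ ω^_
  ω^_·suc_ : Maybe A → ℕ → CNF
  ω^ e ·suc k = (e , k) ∷ []

  ω^_ : Maybe A → CNF
  ω^ e = ω^ e ·suc 0

  ≤ω⇒coefficient≤ : ∀ {d m k α} → ω^ d ·suc m ≤ω ((d , k) ∷ α) → m ≤ k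
  ≤ω⇒coefficient≤ (inj₁ (exp< d<d)) = ⊥-elim (<₁-irrefl d<d)
  ≤ω⇒coefficient≤ (inj₁ (coe< m<k)) = ℕ.<⇒≤ m<k
  ≤ω⇒coefficient≤ (inj₁ (tl< _))    = ℕ.≤-refl
  ≤ω⇒coefficient≤ (inj₂ refl)       = ℕ.≤-refl

  ω^·suc-monoʳ : ∀ {e m n} → m ≤ n → ω^ e ·suc m ≤ω ω^ e ·suc n
  ω^·suc-monoʳ m≤n with ℕ.m≤n⇒m<n∨m≡n m≤n
  ... | inj₁ m<n  = inj₁ (coe< m<n)
  ... | inj₂ refl = inj₂ refl

  HeadBelow : Maybe A → CNF → Set
  HeadBelow E []            = ⊤
  HeadBelow E ((d , _) ∷ _) = d <₁ E

  headBelow⇒<ω^ : ∀ {E} α → HeadBelow E α → α <ω ω^ E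
  headBelow⇒<ω^ []      _   = []<
  headBelow⇒<ω^ (_ ∷ _) d<E = exp< d<E

  <ω^⇒headBelow : ∀ {E} α → α <ω ω^ E → HeadBelow E α
  <ω^⇒headBelow []      _        = tt
  <ω^⇒headBelow (_ ∷ _) (exp< p) = p

  headBelow-weaken : ∀ {e E} α → HeadBelow e α → e <₁ E → HeadBelow E α
  headBelow-weaken []      _   _   = tt
  headBelow-weaken (_ ∷ _) d<e e<E = <₁-trans d<e e<E

  normal-tail : ∀ {t α} → Decreasing (t ∷ α) → Decreasing α
  normal-tail dec-1       = dec-[]
  normal-tail (dec-∷ _ n) = n

  normal-headBelow : ∀ {a k α} → Decreasing ((a , k) ∷ α) → HeadBelow a α
  normal-headBelow dec-1       = tt
  normal-headBelow (dec-∷ p _) = p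

  normal-∷ : ∀ {a k α} → Decreasing α → HeadBelow a α → Decreasing ((a , k) ∷ α)
  normal-∷ dec-[]      _ = dec-1
  normal-∷ dec-1       p = dec-∷ p dec-1
  normal-∷ (dec-∷ q n) p = dec-∷ p (dec-∷ q n)

  -- Ordinal addition: the terms of α below the leading exponent of β are absorbed.
  infixl 30 _⊕_
  _⊕_ : CNF → CNF → CNF
  [] ⊕ β = β
  (t ∷ α) ⊕ [] = t ∷ α
  ((a , k) ∷ α) ⊕ ((d , j) ∷ β) with <₁-cmp d a
  ... | tri< _ _ _ = (a , k) ∷ (α ⊕ ((d , j) ∷ β))
  ... | tri≈ _ _ _ = (a , suc (k + j)) ∷ β
  ... | tri> _ _ _ = (d , j) ∷ β

  ⊕-identityʳ : ∀ α → α ⊕ [] ≡ α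
  ⊕-identityʳ []      = refl
  ⊕-identityʳ (_ ∷ _) = refl

  ⊕-headBelow : ∀ {E} α β → HeadBelow E α → HeadBelow E β → HeadBelow E (α ⊕ β)
  ⊕-headBelow []            β             _ q = q
  ⊕-headBelow (_ ∷ _)       []            p _ = p
  ⊕-headBelow ((a , k) ∷ α) ((d , j) ∷ β) p q with <₁-cmp d a
  ... | tri< _ _ _ = p
  ... | tri≈ _ _ _ = p
  ... | tri> _ _ _ = q

  ⊕-headBelowʳ : ∀ {E} α β → HeadBelow E (α ⊕ β) → HeadBelow E β
  ⊕-headBelowʳ []            β             q = q
  ⊕-headBelowʳ (_ ∷ _)       []            _ = tt
  ⊕-headBelowʳ ((a , k) ∷ α) ((d , j) ∷ β) q with <₁-cmp d a
  ... | tri< d<a _ _ = <₁-trans d<a q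
  ... | tri≈ _ refl _ = q
  ... | tri> _ _ _ = q

  ⊕-normal : ∀ α β → Decreasing α → Decreasing β → Decreasing (α ⊕ β)
  ⊕-normal []            β             _  nβ = nβ
  ⊕-normal (_ ∷ _)       []            nα _  = nα
  ⊕-normal ((a , k) ∷ α) ((d , j) ∷ β) nα nβ with <₁-cmp d a
  ... | tri< d<a _ _ = normal-∷ (⊕-normal α _ (normal-tail nα) nβ)
                                (⊕-headBelow α ((d , j) ∷ β) (normal-headBelow nα) d<a)
  ... | tri≈ _ refl _ = normal-∷ (normal-tail nβ) (normal-headBelow nβ)
  ... | tri> _ _ _ = nβ

  <ω-⊕ : ∀ α t β → α <ω α ⊕ (t ∷ β)
  <ω-⊕ []            t       β = []<
  <ω-⊕ ((a , k) ∷ α) (d , j) β with <₁-cmp d a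
  ... | tri< _ _ _ = tl< (<ω-⊕ α (d , j) β)
  ... | tri≈ _ refl _ = coe< (s≤s (ℕ.m≤m+n k j))
  ... | tri> _ _ a<d = exp< a<d

  ≤ω-⊕ : ∀ α β → α ≤ω α ⊕ β
  ≤ω-⊕ α []      = inj₂ (sym (⊕-identityʳ α))
  ≤ω-⊕ α (t ∷ β) = inj₁ (<ω-⊕ α t β)

  addCoefficient-< : ∀ {a j j′ β γ} k → ((a , j) ∷ β) <ω ((a , j′) ∷ γ) →
                     ((a , suc (k + j)) ∷ β) <ω ((a , suc (k + j′)) ∷ γ)
  addCoefficient-< k (exp< a<a) = ⊥-elim (<₁-irrefl a<a)
  addCoefficient-< k (coe< j<j′) = coe< (s≤s (ℕ.+-monoʳ-< k j<j′))
  addCoefficient-< k (tl< β<γ)   = tl< β<γ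

  ⊕-monoʳ-< : ∀ α {β γ} → β <ω γ → α ⊕ β <ω α ⊕ γ
  ⊕-monoʳ-< []      β<γ = β<γ
  ⊕-monoʳ-< (t ∷ α) {[]} {t′ ∷ γ} []< = <ω-⊕ (t ∷ α) t′ γ
  ⊕-monoʳ-< ((a , k) ∷ α) {(d , j) ∷ β} {(d′ , j′) ∷ γ} β<γ with <₁-cmp d a | <₁-cmp d′ a
  ... | tri< _ _ _    | tri< _ _ _    = tl< (⊕-monoʳ-< α β<γ)
  ... | tri< _ _ _    | tri≈ _ refl _ = coe< (s≤s (ℕ.m≤m+n k j′))
  ... | tri< _ _ _    | tri> _ _ a<d′ = exp< a<d′
  ... | tri≈ _ refl _ | tri< d′<a _ _ =
    ⊥-elim (<₁-irrefl (O₁.<-≤-trans d′<a (head-≤₁ (inj₁ β<γ))))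
  ... | tri≈ _ refl _ | tri≈ _ refl _ = addCoefficient-< k β<γ
  ... | tri≈ _ refl _ | tri> _ _ a<d′ = exp< a<d′
  ... | tri> _ _ a<d  | tri< d′<a _ _ =
    ⊥-elim (<₁-irrefl (<₁-trans a<d (O₁.≤-<-trans (head-≤₁ (inj₁ β<γ)) d′<a)))
  ... | tri> _ _ a<d  | tri≈ _ refl _ =
    ⊥-elim (<₁-irrefl (O₁.<-≤-trans a<d (head-≤₁ (inj₁ β<γ))))
  ... | tri> _ _ _    | tri> _ _ _    = β<γ

  ⊕-difference : ∀ α γ → Decreasing α → Decreasing γ → α ≤ω γ →
                 ∃ λ δ → Decreasing δ × α ⊕ δ ≡ γ
  ⊕-difference []      γ _ nγ _           = γ , nγ , refl
  ⊕-difference (_ ∷ _) _ _ _  (inj₂ refl) = [] , dec-[] , refl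
  ⊕-difference ((a , k) ∷ α) ((c , m) ∷ γ) _ nγ (inj₁ (exp< a<c)) = (c , m) ∷ γ , nγ , absorbed
    where
    absorbed : ((a , k) ∷ α) ⊕ ((c , m) ∷ γ) ≡ (c , m) ∷ γ
    absorbed with <₁-cmp c a
    ... | tri< c<a _ _ = ⊥-elim (O₁.<-asym c<a a<c)
    ... | tri≈ _ refl _ = ⊥-elim (<₁-irrefl a<c)
    ... | tri> _ _ _ = refl
  ⊕-difference ((a , k) ∷ α) ((a , m) ∷ γ) _ nγ (inj₁ (coe< k<m)) with ℕ.m≤n⇒∃[o]m+o≡n k<m
  ... | D , refl = (a , D) ∷ γ , normal-∷ (normal-tail nγ) (normal-headBelow nγ) , merged
    where
    merged : ((a , k) ∷ α) ⊕ ((a , D) ∷ γ) ≡ (a , suc (k + D)) ∷ γ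
    merged with <₁-cmp a a
    ... | tri< a<a _ _ = ⊥-elim (<₁-irrefl a<a)
    ... | tri≈ _ _ _ = refl
    ... | tri> _ _ a<a = ⊥-elim (<₁-irrefl a<a)
  ⊕-difference ((a , k) ∷ α) ((a , k) ∷ γ) nα nγ (inj₁ (tl< α<γ))
    with ⊕-difference α γ (normal-tail nα) (normal-tail nγ) (inj₁ α<γ)
  ... | [] , _ , α⊕[]≡γ =
    ⊥-elim (<ω-irrefl (subst (α <ω_) (trans (sym α⊕[]≡γ) (⊕-identityʳ α)) α<γ))
  ... | (d , j) ∷ δ , nδ , α⊕δ≡γ = (d , j) ∷ δ , nδ , prepended
    where
    d<a : d <₁ a
    d<a = ⊕-headBelowʳ α ((d , j) ∷ δ) (subst (HeadBelow a) (sym α⊕δ≡γ) (normal-headBelow nγ))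
    prepended : ((a , k) ∷ α) ⊕ ((d , j) ∷ δ) ≡ (a , k) ∷ γ
    prepended with <₁-cmp d a
    ... | tri< _ _ _ = cong ((a , k) ∷_) α⊕δ≡γ
    ... | tri≈ _ refl _ = ⊥-elim (<₁-irrefl d<a)
    ... | tri> _ _ a<d = ⊥-elim (O₁.<-asym a<d d<a)

  ⊕-cancelˡ : ∀ α {β γ} → α ⊕ β ≡ α ⊕ γ → β ≡ γ
  ⊕-cancelˡ α {β} {γ} eq with <ω-cmp β γ
  ... | tri< β<γ _ _ = ⊥-elim (<ω-irrefl (subst (_<ω α ⊕ γ) eq (⊕-monoʳ-< α β<γ)))
  ... | tri≈ _ β≡γ _ = β≡γ
  ... | tri> _ _ γ<β = ⊥-elim (<ω-irrefl (subst (α ⊕ γ <ω_) eq (⊕-monoʳ-< α γ<β)))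

  ⊕-cancelˡ-< : ∀ α {β γ} → α ⊕ β <ω α ⊕ γ → β <ω γ
  ⊕-cancelˡ-< α {β} {γ} lt with <ω-cmp β γ
  ... | tri< β<γ _ _ = β<γ
  ... | tri≈ _ refl _ = ⊥-elim (<ω-irrefl lt)
  ... | tri> _ _ γ<β = ⊥-elim (Oω.<-asym lt (⊕-monoʳ-< α γ<β))

  ω^≤ω⊕ω^ : ∀ α e → ω^ e ≤ω α ⊕ ω^ e
  ω^≤ω⊕ω^ []            e = inj₂ refl
  ω^≤ω⊕ω^ ((a , k) ∷ α) e with <₁-cmp e a
  ... | tri< e<a _ _ = inj₁ (exp< e<a)
  ... | tri≈ _ refl _ = inj₁ (coe< (s≤s z≤n))
  ... | tri> _ _ _ = inj₂ refl

  ω^·suc≤ω⊕ω^ : ∀ α {d m e} → d ≤₁ e → ω^ d ·suc m ≤ω α → ω^ d ·suc (suc m) ≤ω α ⊕ ω^ e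
  ω^·suc≤ω⊕ω^ α {e = e} (inj₁ d<e) _ = inj₁ (Oω.<-≤-trans (exp< d<e) (ω^≤ω⊕ω^ α e))
  ω^·suc≤ω⊕ω^ [] (inj₂ refl) (inj₁ ())
  ω^·suc≤ω⊕ω^ [] (inj₂ refl) (inj₂ ())
  ω^·suc≤ω⊕ω^ ((a , k) ∷ α) {d} (inj₂ refl) dm≤α with <₁-cmp d a
  ... | tri< d<a _ _ = inj₁ (exp< d<a)
  ... | tri≈ _ refl _ = ω^·suc-monoʳ (s≤s (ℕ.≤-trans (≤ω⇒coefficient≤ dm≤α) (ℕ.m≤m+n k 0)))
  ... | tri> _ _ a<d = ⊥-elim (<₁-irrefl (O₁.<-≤-trans a<d (head-≤₁ dm≤α)))

module OrderTypes {Q : Set} (_≤Q_ : Q → Q → Set)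
                  {A : Set} {_⊏_ : A → A → Set} (⊏-sto : IsStrictTotalOrder _≡_ _⊏_) where

  open Sequences _≤Q_
  open OmegaPower _⊏_
  open CantorNormalForm ⊏-sto

  record HasOrderType (u : Seq Q) (e₀ : CNF) : Set where
    field
      pos            : Carrier u → CNF
      pos-normal     : ∀ a → Decreasing (pos a)
      pos-below      : ∀ a → pos a <ω e₀
      pos-mono       : ∀ a b → u ∶ a ≺ b → pos a <ω pos b
      pos-reflects   : ∀ a b → pos a <ω pos b → u ∶ a ≺ b
      pos-injective  : ∀ a b → pos a ≡ pos b → a ≡ b
      pos-surjective : ∀ e → Decreasing e → e <ω e₀ → ∃ λ a → pos a ≡ e

  lengthBelow : ∀ {u e₀} → Decreasing e₀ → HasOrderType u e₀ → LengthBelow u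
  lengthBelow {e₀ = e₀} e₀-normal T =
    e₀ , e₀-normal , pos , (λ a → pos-normal a , pos-below a) ,
    pos-mono , pos-reflects , pos-injective , pos-surjective
    where open HasOrderType T

  single-orderType : ∀ q → HasOrderType (single q) (ω^ nothing)
  single-orderType q = record
    { pos            = λ _ → []
    ; pos-normal     = λ _ → dec-[]
    ; pos-below      = λ _ → []<
    ; pos-mono       = λ _ _ ()
    ; pos-reflects   = λ _ _ ()
    ; pos-injective  = λ _ _ _ → refl
    ; pos-surjective = only-[]
    }
    where
    only-[] : ∀ e → Decreasing e → e <ω ω^ nothing → ∃ λ _ → [] ≡ e
    only-[] []      _ _        = tt , refl
    only-[] (_ ∷ _) _ (exp< ())

  module PartialSums (g : ℕ → Maybe A) where

    S : ℕ → CNF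
    S zero    = []
    S (suc i) = S i ⊕ ω^ g i

    S-normal : ∀ i → Decreasing (S i)
    S-normal zero    = dec-[]
    S-normal (suc i) = ⊕-normal (S i) _ (S-normal i) dec-1

    S-headBelow : ∀ {E} → (∀ i → g i <₁ E) → ∀ i → HeadBelow E (S i)
    S-headBelow g<E zero    = tt
    S-headBelow g<E (suc i) = ⊕-headBelow (S i) (ω^ g i) (S-headBelow g<E i) (g<E i)

    S-mono : ∀ {i j} → i ≤ j → S i ≤ω S j
    S-mono {j = zero} z≤n = inj₂ refl
    S-mono {i} {suc j} i≤1+j with ℕ.m≤n⇒m<n∨m≡n i≤1+j
    ... | inj₁ (s≤s i≤j) = Oω.≤-trans (S-mono i≤j) (≤ω-⊕ (S j) _)
    ... | inj₂ refl      = inj₂ refl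

    S-bracket : ∀ γ I → γ <ω S I → ∃ λ i → S i ≤ω γ × γ <ω S (suc i)
    S-bracket γ zero    ()
    S-bracket γ (suc I) γ<S[1+I] with <ω-cmp γ (S I)
    ... | tri< γ<S[I] _ _ = S-bracket γ I γ<S[I]
    ... | tri≈ _ γ≡S[I] _ = I , inj₂ (sym γ≡S[I]) , γ<S[1+I]
    ... | tri> _ _ S[I]<γ = I , inj₁ S[I]<γ , γ<S[1+I]

    module _ {E} (cofinal : ∀ d → d <₁ E → ∀ N → ∃ λ i → N ≤ i × d ≤₁ g i) where

      S-dominates : ∀ d → d <₁ E → ∀ m → ∃ λ I → ω^ d ·suc m ≤ω S I
      S-dominates d d<E zero with cofinal d d<E 0
      ... | i , _ , d≤gi =
        suc i , Oω.≤-trans (Sum.map exp< (cong ω^_) d≤gi) (ω^≤ω⊕ω^ (S i) (g i))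
      S-dominates d d<E (suc m) with S-dominates d d<E m
      ... | I , dm≤S[I] with cofinal d d<E I
      ... | i , I≤i , d≤gi = suc i , ω^·suc≤ω⊕ω^ (S i) d≤gi (Oω.≤-trans dm≤S[I] (S-mono I≤i))

      S-unbounded : ∀ γ → γ <ω ω^ E → ∃ λ I → γ <ω S I
      S-unbounded []            _      = 1 , []<
      S-unbounded ((d , k) ∷ γ) γ<ω^E with S-dominates d (<ω^⇒headBelow _ γ<ω^E) (suc k)
      ... | I , dk≤S[I] = I , Oω.<-≤-trans (coe< ℕ.≤-refl) dk≤S[I]

  -- Block i of the concatenation is placed at S i = ω^(g 0) + ⋯ + ω^(g (i-1)).
  conc-orderType : ∀ {us : ℕ → Seq Q} {g : ℕ → Maybe A} {E} →
                   (∀ i → HasOrderType (us i) (ω^ g i)) → (∀ i → g i <₁ E) →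
                   (∀ d → d <₁ E → ∀ N → ∃ λ i → N ≤ i × d ≤₁ g i) →
                   HasOrderType (conc us) (ω^ E)
  conc-orderType {us} {g} {E} T g<E cofinal = record
    { pos            = Φ
    ; pos-normal     = λ (i , a) → ⊕-normal (S i) _ (S-normal i) (T.pos-normal i a)
    ; pos-below      = Φ-below
    ; pos-mono       = Φ-mono
    ; pos-reflects   = Φ-reflects
    ; pos-injective  = Φ-injective
    ; pos-surjective = Φ-surjective
    }
    where
    open PartialSums g
    module T i = HasOrderType (T i)

    Φ : Carrier (conc us) → CNF
    Φ (i , a) = S i ⊕ T.pos i a

    Φ-below : ∀ p → Φ p <ω ω^ E
    Φ-below (i , a) = headBelow⇒<ω^ (Φ (i , a))
      (⊕-headBelow (S i) (T.pos i a) (S-headBelow g<E i)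
        (headBelow-weaken (T.pos i a) (<ω^⇒headBelow _ (T.pos-below i a)) (g<E i)))

    Φ-mono : ∀ p q → conc us ∶ p ≺ q → Φ p <ω Φ q
    Φ-mono (i , a) (j , b) (lt-out i<j) =
      Oω.<-≤-trans (⊕-monoʳ-< (S i) (T.pos-below i a))
                   (Oω.≤-trans (S-mono i<j) (≤ω-⊕ (S j) (T.pos j b)))
    Φ-mono (i , a) (i , b) (lt-in a<b) = ⊕-monoʳ-< (S i) (T.pos-mono i a b a<b)

    Φ-reflects : ∀ p q → Φ p <ω Φ q → conc us ∶ p ≺ q
    Φ-reflects (i , a) (j , b) Φp<Φq with ℕ.<-cmp i j
    ... | tri< i<j _ _ = lt-out i<j
    ... | tri≈ _ refl _ = lt-in (T.pos-reflects i a b (⊕-cancelˡ-< (S i) Φp<Φq))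
    ... | tri> _ _ j<i = ⊥-elim (Oω.<-asym Φp<Φq (Φ-mono _ _ (lt-out j<i)))

    Φ-injective : ∀ p q → Φ p ≡ Φ q → p ≡ q
    Φ-injective (i , a) (j , b) Φp≡Φq with ℕ.<-cmp i j
    ... | tri< i<j _ _ =
      ⊥-elim (<ω-irrefl (subst (_<ω Φ (j , b)) Φp≡Φq (Φ-mono _ _ (lt-out i<j))))
    ... | tri≈ _ refl _ = cong (i ,_) (T.pos-injective i a b (⊕-cancelˡ (S i) Φp≡Φq))
    ... | tri> _ _ j<i =
      ⊥-elim (<ω-irrefl (subst (Φ (j , b) <ω_) Φp≡Φq (Φ-mono _ _ (lt-out j<i))))

    Φ-surjective : ∀ γ → Decreasing γ → γ <ω ω^ E → ∃ λ p → Φ p ≡ γ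
    Φ-surjective γ γ-normal γ<ω^E with S-unbounded cofinal γ γ<ω^E
    ... | I , γ<S[I] with S-bracket γ I γ<S[I]
    ... | i , S[i]≤γ , γ<S[1+i] with ⊕-difference (S i) γ (S-normal i) γ-normal S[i]≤γ
    ... | δ , δ-normal , S[i]⊕δ≡γ
      with T.pos-surjective i δ δ-normal
             (⊕-cancelˡ-< (S i) (subst (_<ω S (suc i)) (sym S[i]⊕δ≡γ) γ<S[1+i]))
    ... | a , pos≡δ = (i , a) , trans (cong (S i ⊕_) pos≡δ) S[i]⊕δ≡γ

eventuallyConstant : ExcludedMiddle 0ℓ → {X : Set} {_≺_ : X → X → Set}
                     (φ : X → ℕ) → (∀ {a b} → a ≺ b → φ a ≤ φ b) →
                     ∀ B → (∀ a → φ a ≤ B) → X → ∃₂ λ a j → ∀ b → a ≡ b ⊎ a ≺ b → φ b ≡ j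
eventuallyConstant em φ φ-mono zero    φ≤0 x = x , 0 , λ b _ → ℕ.n≤0⇒n≡0 (φ≤0 b)
eventuallyConstant em φ φ-mono (suc B) φ≤1+B x with em {∃ λ c → suc B ≤ φ c}
... | yes (c , 1+B≤φc) = c , suc B , λ where
        b (inj₁ refl) → ℕ.≤-antisym (φ≤1+B b) 1+B≤φc
        b (inj₂ c≺b)  → ℕ.≤-antisym (φ≤1+B b) (ℕ.≤-trans 1+B≤φc (φ-mono c≺b))
... | no ∄ = eventuallyConstant em φ φ-mono B (λ a → ℕ.≮⇒≥ (λ B<φa → ∄ (a , B<φa))) x

module Embeddings {Q : Set} (_≤Q_ : Q → Q → Set)
                  (≤Q-refl : Reflexive _≤Q_) (≤Q-trans : Transitive _≤Q_) where

  open Sequences _≤Q_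

  ⪯-refl : ∀ {u} → u ⪯ u
  ⪯-refl = id , (λ _ _ → id) , λ _ → ≤Q-refl

  ⪯-trans : ∀ {u v w} → u ⪯ v → v ⪯ w → u ⪯ w
  ⪯-trans (F , F-mono , F-lab) (G , G-mono , G-lab) =
    G ∘ F , (λ a b → G-mono (F a) (F b) ∘ F-mono a b) , λ a → ≤Q-trans (F-lab a) (G-lab (F a))

  ⪯*-trans : ∀ {u v w} → u ⪯* v → v ⪯* w → u ⪯* w
  ⪯*-trans (F , F-mono , F-lab) (G , G-mono , G-lab) =
    G ∘ F , (λ a b → Sum.[ inj₁ ∘ cong G , G-mono (F a) (F b) ] ∘ F-mono a b) ,
    λ a → ≤Q-trans (F-lab a) (G-lab (F a))

  ⪯⇒⪯* : ∀ {u v} → u ⪯ v → u ⪯* v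
  ⪯⇒⪯* (F , F-mono , F-lab) = F , (λ a b → inj₂ ∘ F-mono a b) , F-lab

  single-⪯ : ∀ {q v} (c : Carrier v) → q ≤Q lab v c → single q ⪯ v
  single-⪯ c q≤c = (λ _ → c) , (λ _ _ ()) , λ _ → q≤c

  ⪯*-single : ∀ {u p} → (∀ a → lab u a ≤Q p) → u ⪯* single p
  ⪯*-single a≤p = (λ _ → tt) , (λ _ _ _ → inj₁ refl) , a≤p

  Tail-⪯ : ∀ u t → Tail u t ⪯ u
  Tail-⪯ u t = proj₁ , (λ _ _ → id) , λ _ → ≤Q-refl

  ⪯-Tail : ∀ {u v} t (F : u ⪯ v) → (∀ a → t ≡ proj₁ F a ⊎ v ∶ t ≺ proj₁ F a) → u ⪯ Tail v t
  ⪯-Tail t (F , F-mono , F-lab) t≤F = (λ a → F a , t≤F a) , F-mono , F-lab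

  block : {B : ℕ → Set} → Σ ℕ B → ℕ
  block = proj₁

  block-mono : ∀ {us p q} → conc us ∶ p ≺ q → block p ≤ block q
  block-mono (lt-out i<j) = ℕ.<⇒≤ i<j
  block-mono (lt-in _)    = ℕ.≤-refl

  block-mono* : ∀ {us p q} → p ≡ q ⊎ conc us ∶ p ≺ q → block p ≤ block q
  block-mono* (inj₁ refl) = ℕ.≤-refl
  block-mono* (inj₂ p<q)  = block-mono p<q

  block-⪯ : ∀ us i → us i ⪯ conc us
  block-⪯ us i = (i ,_) , (λ _ _ → lt-in) , λ _ → ≤Q-refl

  ⪯-restrict : ∀ us i {w} → conc us ⪯ w → us i ⪯ w
  ⪯-restrict us i {w} = ⪯-trans {us i} {conc us} {w} (block-⪯ us i)

  ⪯*-restrict : ∀ us i {w} → conc us ⪯* w → us i ⪯* w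
  ⪯*-restrict us i {w} =
    ⪯*-trans {us i} {conc us} {w} (⪯⇒⪯* {us i} {conc us} (block-⪯ us i))

  module _ (vs : ℕ → Seq Q) {j : ℕ} where

    unblock : (p : Carrier (conc vs)) → block p ≡ j → Carrier (vs j)
    unblock (_ , b) refl = b

    unblock-≺ : ∀ {p q} (p∈j : block p ≡ j) (q∈j : block q ≡ j) →
                conc vs ∶ p ≺ q → vs j ∶ unblock p p∈j ≺ unblock q q∈j
    unblock-≺ {_ , _} {_ , _} refl refl (lt-out j<j) = ⊥-elim (ℕ.<-irrefl refl j<j)
    unblock-≺ {_ , _} {_ , _} refl refl (lt-in b<c)  = b<c

    unblock-≡ : ∀ {p q} (p∈j : block p ≡ j) (q∈j : block q ≡ j) →
                p ≡ q → unblock p p∈j ≡ unblock q q∈j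
    unblock-≡ {_ , _} refl refl refl = refl

    unblock-lab : ∀ p (p∈j : block p ≡ j) → lab (conc vs) p ≡ lab (vs j) (unblock p p∈j)
    unblock-lab (_ , _) refl = refl

  ⪯-unblock : ∀ {u} vs {j} (F : u ⪯ conc vs) → (∀ a → block (proj₁ F a) ≡ j) → u ⪯ vs j
  ⪯-unblock {u} vs (F , F-mono , F-lab) F∈j =
    (λ a → unblock vs (F a) (F∈j a)) ,
    (λ a b → unblock-≺ vs (F∈j a) (F∈j b) ∘ F-mono a b) ,
    λ a → subst (lab u a ≤Q_) (unblock-lab vs (F a) (F∈j a)) (F-lab a)

  ⪯*-unblock : ∀ {u} vs {j} (F : u ⪯* conc vs) → (∀ a → block (proj₁ F a) ≡ j) → u ⪯* vs j
  ⪯*-unblock {u} vs (F , F-mono , F-lab) F∈j =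
    (λ a → unblock vs (F a) (F∈j a)) ,
    (λ a b → Sum.map (unblock-≡ vs (F∈j a) (F∈j b)) (unblock-≺ vs (F∈j a) (F∈j b))
             ∘ F-mono a b) ,
    λ a → subst (lab u a ≤Q_) (unblock-lab vs (F a) (F∈j a)) (F-lab a)

  conc-⪯-beyond : ∀ {us vs} → (∀ k N → ∃ λ l → N < l × us k ⪯ vs l) →
                  ∀ N → Σ (conc us ⪯ conc vs) λ F → ∀ p → N < block (proj₁ F p)
  conc-⪯-beyond {us} {vs} far N = (F , F-mono , F-lab) , λ (k , _) → N<σ k
    where
    open IncreasingChoice far N

    F : Carrier (conc us) → Carrier (conc vs)
    F (k , a) = σ k , proj₁ (σ-spec k) a

    F-mono : ∀ p q → conc us ∶ p ≺ q → conc vs ∶ F p ≺ F q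
    F-mono (k , a) (l , b) (lt-out k<l) = lt-out (σ-strictMono k<l)
    F-mono (k , a) (k , b) (lt-in a<b)  = lt-in (proj₁ (proj₂ (σ-spec k)) a b a<b)

    F-lab : ∀ p → lab (conc us) p ≤Q lab (conc vs) (F p)
    F-lab (k , a) = proj₂ (proj₂ (σ-spec k)) a

  conc-⪯ : ∀ {us vs} → (∀ k N → ∃ λ l → N < l × us k ⪯ vs l) → conc us ⪯ conc vs
  conc-⪯ far = proj₁ (conc-⪯-beyond far 0)

  conc-⪯* : ∀ {us vs} → (∀ k N → ∃ λ l → N < l × us k ⪯* vs l) → conc us ⪯* conc vs
  conc-⪯* {us} {vs} far = F , F-mono , F-lab
    where
    open IncreasingChoice far 0

    F : Carrier (conc us) → Carrier (conc vs)
    F (k , a) = σ k , proj₁ (σ-spec k) a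

    F-mono : ∀ p q → conc us ∶ p ≺ q → F p ≡ F q ⊎ conc vs ∶ F p ≺ F q
    F-mono (k , a) (l , b) (lt-out k<l) = inj₂ (lt-out (σ-strictMono k<l))
    F-mono (k , a) (k , b) (lt-in a<b)  =
      Sum.map (cong (σ k ,_)) lt-in (proj₁ (proj₂ (σ-spec k)) a b a<b)

    F-lab : ∀ p → lab (conc us) p ≤Q lab (conc vs) (F p)
    F-lab (k , a) = proj₂ (proj₂ (σ-spec k)) a

  conc-indecomposable : ∀ {us} → (∀ k N → ∃ λ l → N < l × us k ⪯ us l) →
                        Indecomposable (conc us)
  conc-indecomposable {us} recurs (i , a) =
    let F , beyond-i = conc-⪯-beyond {us} {us} recurs i
    in ⪯-Tail {v = conc us} (i , a) F (λ p → inj₂ (lt-out (beyond-i p)))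

  module _ (em : ExcludedMiddle 0ℓ) where

    ⪯-someBlock : ∀ {u} vs → Indecomposable u → Carrier u → (F : u ⪯ conc vs) →
                  ∀ B → (∀ a → block (proj₁ F a) ≤ B) → ∃ λ j → u ⪯ vs j
    ⪯-someBlock {u} vs u-indec x F B F≤B
      with eventuallyConstant em (block ∘ proj₁ F) (λ {a} {b} → block-mono ∘ proj₁ (proj₂ F) a b)
                              B F≤B x
    ... | a , j , constant = j , ⪯-unblock vs G (λ c → constant _ (proj₂ (proj₁ (u-indec a) c)))
      where
      G : u ⪯ conc vs
      G = ⪯-trans {u} {Tail u a} {conc vs} (u-indec a)
            (⪯-trans {Tail u a} {u} {conc vs} (Tail-⪯ u a) F)

    ⪯*-someBlock : ∀ {u} vs → WeaklyIndecomposable u → Carrier u → (F : u ⪯* conc vs) →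
                   ∀ B → (∀ a → block (proj₁ F a) ≤ B) → ∃ λ j → u ⪯* vs j
    ⪯*-someBlock {u} vs u-indec x F B F≤B
      with eventuallyConstant em (block ∘ proj₁ F) (λ {a} {b} → block-mono* ∘ proj₁ (proj₂ F) a b)
                              B F≤B x
    ... | a , j , constant = j , ⪯*-unblock vs G (λ c → constant _ (proj₂ (proj₁ (u-indec a) c)))
      where
      G : u ⪯* conc vs
      G = ⪯*-trans {u} {Tail u a} {conc vs} (u-indec a)
            (⪯*-trans {Tail u a} {u} {conc vs} (⪯⇒⪯* {Tail u a} {u} (Tail-⪯ u a)) F)

module Representation {Q : Set} (_≤Q_ : Q → Q → Set)
                      (≤Q-refl : Reflexive _≤Q_) (≤Q-trans : Transitive _≤Q_) where

  open Embeddability _≤Q_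
  open Sequences _≤Q_
  open Embeddings _≤Q_ ≤Q-refl ≤Q-trans

  blocks : (ℕ → V Q) → ℕ → Seq Q
  blocks f i = ι (f (h i))

  point : ∀ x → Carrier (ι x)
  point (ur q) = tt
  point (st f) = 0 , point (f (h 0))

  ι-indecomposable : ∀ x → Indecomposable (ι x)
  ι-indecomposable (ur q) tt = ⪯-Tail {single q} {single q} tt ⪯-refl (λ _ → inj₁ refl)
  ι-indecomposable (st f)    =
    conc-indecomposable λ k → h-recurring (λ m → ι (f (h k)) ⪯ ι (f m)) ⪯-refl

  ι-weaklyIndecomposable : ∀ x → WeaklyIndecomposable (ι x)
  ι-weaklyIndecomposable x a = ⪯⇒⪯* {ι x} {Tail (ι x) a} (ι-indecomposable x a)

  ≲⇒ι⪯ : ∀ x y → x ≲ y → ι x ⪯ ι y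
  ≲⇒ι⪯ (ur q) (ur p) q≤p          = single-⪯ tt q≤p
  ≲⇒ι⪯ (ur q) (st g) (m , q≲gm)   =
    let l , _ , q⪯gl = h-recurring (λ k → single q ⪯ ι (g k)) (≲⇒ι⪯ (ur q) (g m) q≲gm) 0
    in ⪯-trans {single q} {blocks g l} {ι (st g)} q⪯gl (block-⪯ (blocks g) l)
  ≲⇒ι⪯ (st f) (st g) f≲g          =
    conc-⪯ λ k → h-recurring (λ m → blocks f k ⪯ ι (g m)) (≲⇒ι⪯ (f (h k)) _ (proj₂ (f≲g (h k))))

  ≲*⇒ι⪯* : ∀ x y → x ≲* y → ι x ⪯* ι y
  ≲*⇒ι⪯* (ur q) (ur p) q≤p        = ⪯*-single (λ _ → q≤p)
  ≲*⇒ι⪯* (ur q) (st g) (m , q≲gm) =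
    let l , _ , q⪯gl = h-recurring (λ k → single q ⪯* ι (g k)) (≲*⇒ι⪯* (ur q) (g m) q≲gm) 0
    in ⪯*-trans {single q} {blocks g l} {ι (st g)} q⪯gl
         (⪯⇒⪯* {blocks g l} {ι (st g)} (block-⪯ (blocks g) l))
  ≲*⇒ι⪯* (st f) (ur p) f≲p        =
    ⪯*-single λ (k , a) → proj₂ (proj₂ (≲*⇒ι⪯* (f (h k)) (ur p) (f≲p (h k)))) a
  ≲*⇒ι⪯* (st f) (st g) f≲g        =
    conc-⪯* λ k →
      h-recurring (λ m → blocks f k ⪯* ι (g m)) (≲*⇒ι⪯* (f (h k)) _ (proj₂ (f≲g (h k))))

  module _ (em : ExcludedMiddle 0ℓ) where

    ι⪯⇒≲ : ∀ x y → ι x ⪯ ι y → x ≲ y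
    ι⪯⇒≲ (ur q) (ur p) (_ , _ , F-lab) = F-lab tt
    ι⪯⇒≲ (ur q) (st g) F =
      let j = block (proj₁ F tt)
      in h j , ι⪯⇒≲ (ur q) (g (h j)) (⪯-unblock (blocks g) F λ _ → refl)
    ι⪯⇒≲ (st f) (ur p) (_ , F-mono , _) =
      F-mono (0 , point (f (h 0))) (1 , point (f (h 1))) (lt-out (s≤s z≤n))
    ι⪯⇒≲ (st f) (st g) F n with h-preimage n 0
    ... | i , _ , refl
      with ⪯-someBlock em (blocks g) (ι-indecomposable (f (h i))) (point (f (h i)))
             (⪯-restrict (blocks f) i {ι (st g)} F)
             (block (proj₁ F (suc i , point (f (h (suc i))))))
             (λ a → block-mono (proj₁ (proj₂ F) (i , a) _ (lt-out ℕ.≤-refl)))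
    ... | j , E = h j , ι⪯⇒≲ (f (h i)) (g (h j)) E

    ι⪯*⇒≲* : ∀ x y → ι x ⪯* ι y → x ≲* y
    ι⪯*⇒≲* (ur q) (ur p) (_ , _ , F-lab) = F-lab tt
    ι⪯*⇒≲* (ur q) (st g) F =
      let j = block (proj₁ F tt)
      in h j , ι⪯*⇒≲* (ur q) (g (h j)) (⪯*-unblock (blocks g) F λ _ → refl)
    ι⪯*⇒≲* (st f) (ur p) F n with h-preimage n 0
    ... | i , _ , refl =
      ι⪯*⇒≲* (f (h i)) (ur p) (⪯*-restrict (blocks f) i F)
    ι⪯*⇒≲* (st f) (st g) F n with h-preimage n 0
    ... | i , _ , refl
      with ⪯*-someBlock em (blocks g) (ι-weaklyIndecomposable (f (h i))) (point (f (h i)))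
             (⪯*-restrict (blocks f) i {ι (st g)} F)
             (block (proj₁ F (suc i , point (f (h (suc i))))))
             (λ a → block-mono* (proj₁ (proj₂ F) (i , a) _ (lt-out ℕ.≤-refl)))
    ... | j , E = h j , ι⪯*⇒≲* (f (h i)) (g (h j)) E

module RankedOrderTypes (em : ExcludedMiddle 0ℓ) {Q : Set} (_≤Q_ : Q → Q → Set)
                        {A : Set} {_⊏_ : A → A → Set}
                        (⊏-sto : IsStrictTotalOrder _≡_ _⊏_) (⊏-wf : WellFounded _⊏_) where

  open Sequences _≤Q_
  open Rank {Q} _⊏_
  open OmegaPower _⊏_
  open CantorNormalForm ⊏-sto
  open OrderTypes _≤Q_ ⊏-sto
  open IsStrictTotalOrder ⊏-sto using (compare) renaming (irrefl to ⊏-irrefl; trans to ⊏-trans)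

  module O⊏ = StrictOrderFacts {_<_ = _⊏_} (⊏-irrefl refl) ⊏-trans
  open O⊏ using () renaming (_≤_ to _⊑_)

  IsLeast : (A → Set) → A → Set
  IsLeast P r = P r × ∀ r′ → P r′ → r ⊑ r′

  least : ∀ (P : A → Set) {β} → P β → ∃ (IsLeast P)
  least P {β} = go β (⊏-wf β)
    where
    go : ∀ β → Acc _⊏_ β → P β → ∃ (IsLeast P)
    go β (acc smaller) Pβ with em {∃ λ γ → γ ⊏ β × P γ}
    ... | yes (γ , γ⊏β , Pγ) = go γ (smaller γ⊏β) Pγ
    ... | no ∄ = β , Pβ , λ r Pr → O⊏.≮⇒≥ compare (λ r⊏β → ∄ (r , r⊏β , Pr))

  -- exp is 1 + rk x, written just ρ for 1 + ρ and nothing for 0 (urelements).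
  record Exponent (x : V Q) (r : A) : Set where
    field
      exp       : Maybe A
      orderType : HasOrderType (ι x) (ω^ exp)
      exp<r     : exp <₁ just r
      rank<     : ∀ d → exp <₁ just d → ChildOK x d

  -- Leastness of r makes the exponents of the elements cofinal below 1 + r.
  st-orderType : ∀ f r → IsLeast (RkLe (st f)) r → (∀ n → Exponent (f n) r) →
                 HasOrderType (ι (st f)) (ω^ just r)
  st-orderType f r (_ , r-least) child =
    conc-orderType (λ i → orderType (child (h i))) (λ i → exp<r (child (h i))) cofinal
    where
    open Exponent

    e : ℕ → Maybe A
    e n = exp (child n)

    reached : ∀ d → d <₁ just r → ∃ λ n → d ≤₁ e n
    reached nothing  _          = 0 , nothing≤₁ (e 0)
    reached (just d) (jst< d⊏r) with em {∃ λ n → just d ≤₁ e n}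
    ... | yes found = found
    ... | no ∄ = ⊥-elim (⊏-irrefl refl (O⊏.≤-<-trans (r-least d rank≤d) d⊏r))
      where
      rank≤d : RkLe (st f) d
      rank≤d n = rank< (child n) d (O₁.≰⇒> <₁-cmp (λ d≤eₙ → ∄ (n , d≤eₙ)))

    cofinal : ∀ d → d <₁ just r → ∀ N → ∃ λ i → N ≤ i × d ≤₁ e (h i)
    cofinal d d<r N =
      let n , d≤eₙ = reached d d<r
          i , N<i , d≤e[hi] = h-recurring (λ m → d ≤₁ e m) d≤eₙ N
      in i , ℕ.<⇒≤ N<i , d≤e[hi]

  mutual
    exponent : ∀ x r → ChildOK x r → Exponent x r
    exponent (ur q) r _ = record
      { exp       = nothing
      ; orderType = single-orderType q
      ; exp<r     = bot<
      ; rank<     = λ _ _ → tt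
      }
    exponent (st f) r (γ , γ⊏r , rank≤γ) =
      let ρ , (rank≤ρ , ρ-least) , T = rankedOrderType f rank≤γ
      in record
        { exp       = just ρ
        ; orderType = T
        ; exp<r     = jst< (O⊏.≤-<-trans (ρ-least γ rank≤γ) γ⊏r)
        ; rank<     = λ { d (jst< ρ⊏d) → ρ , ρ⊏d , rank≤ρ }
        }

    rankedOrderType : ∀ f {β} → RkLe (st f) β →
                      ∃ λ ρ → IsLeast (RkLe (st f)) ρ × HasOrderType (ι (st f)) (ω^ just ρ)
    rankedOrderType f rank≤β =
      let ρ , ρ-least = least (RkLe (st f)) rank≤β
      in ρ , ρ-least , st-orderType f ρ ρ-least (λ n → exponent (f n) ρ (proj₁ ρ-least n))

  ι-lengthBelow : ∀ x → InV x → LengthBelow (ι x)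
  ι-lengthBelow (ur q) _            = lengthBelow dec-1 (single-orderType q)
  ι-lengthBelow (st f) (_ , rank≤β) = lengthBelow dec-1 (proj₂ (proj₂ (rankedOrderType f rank≤β)))

mainTheorem8 : ExcludedMiddle 0ℓ →
    (Q : Set) (_≤Q_ : Q → Q → Set) → Reflexive _≤Q_ → Transitive _≤Q_ →
    (A : Set) (_<_ : A → A → Set) → IsStrictTotalOrder _≡_ _<_ → WellFounded _<_ →
    let open Embeddability _≤Q_
        open Sequences _≤Q_
        open Rank {Q} _<_
        open OmegaPower _<_
    in ((x : V Q) → InV x → Indecomposable (ι x) × LengthBelow (ι x))
     × ((x y : V Q) → InV x → InV y → ((x ≲ y → ι x ⪯ ι y) × (ι x ⪯ ι y → x ≲ y)))
     × ((x : V Q) → InV x → WeaklyIndecomposable (ι x) × LengthBelow (ι x))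
     × ((x y : V Q) → InV x → InV y → ((x ≲* y → ι x ⪯* ι y) × (ι x ⪯* ι y → x ≲* y)))
mainTheorem8 em Q _≤Q_ ≤Q-refl ≤Q-trans A _<_ <-sto <-wf =
    (λ x x∈V → ι-indecomposable x , ι-lengthBelow x x∈V)
  , (λ x y _ _ → ≲⇒ι⪯ x y , ι⪯⇒≲ em x y)
  , (λ x x∈V → ι-weaklyIndecomposable x , ι-lengthBelow x x∈V)
  , (λ x y _ _ → ≲*⇒ι⪯* x y , ι⪯*⇒≲* em x y)
  where
  open Representation _≤Q_ ≤Q-refl ≤Q-trans
  open RankedOrderTypes em _≤Q_ <-sto <-wf
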